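{- Let $\mathcal{M}$ be a finite structure with universe $V$ interpreting a binary relation symbol $f$, a binary relation symbol $f^*$, and a ternary relation symbol $R$, where we write $(f^x)^*(u,v)$ for $R(x,u,v)$ and $f^x(u,v)$ abbreviates $f(u,v)\land u\neq x$. Suppose $f^{\mathcal{M}}$ is functional ($\forall u,v,w\,.\,f(u,v)\land f(u,w)\rightarrow v=w$) and $\mathcal{M}$ satisfies the universal closures (over all of $u,v,w,x,y,z$) of Nelson's axioms: (N1) $(f^x)^*(u,v)\leftrightarrow (u=v)\lor\exists z\,.\,(f^x(u,z)\land (f^x)^*(z,v))$; (N2) $(f^x)^*(u,v)\land (f^x)^*(v,w)\rightarrow (f^x)^*(u,w)$; (N3) $(f^x)^*(u,v)\rightarrow f^*(u,v)$; (N4) $(f^y)^*(u,x)\land (f^z)^*(u,y)\rightarrow (f^z)^*(u,x)$; (N5) $f^*(u,x)\rightarrow (f^y)^*(u,x)\lor (f^x)^*(u,y)$; (N6) $(f^y)^*(u,x)\land (f^z)^*(u,y)\rightarrow (f^z)^*(x,y)$; (N7) $f(x,u)\land f^*(u,v)\rightarrow (f^x)^*(u,v)$. Then $\mathcal{M}$ is a TC model: $(f^*)^{\mathcal{M}}$ is the reflexive transitive closure of $f^{\mathcal{M}}$, and for every $x\in V$ the relation $\{(u,v): \mathcal{M}\models R(x,u,v)\}$ is the reflexive transitive closure of $\{(u,v):(u,v)\in f^{\mathcal{M}},\ u\neq x\}$.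
   Context: $(f^x)^*(u,v)$ is intended to mean that there is an $f$-path from $u$ to $v$ that uses no edge leaving $x$. -}

module Defs where

open import Data.Nat using (ℕ)
open import Data.Fin using (Fin)
open import Data.Bool using (Bool; T)
open import Data.Product using (_×_; ∃-syntax)
open import Data.Sum using (_⊎_)
open import Relation.Nullary using (¬_)
open import Relation.Binary.PropositionalEquality using (_≡_)
open import Relation.Binary.Construct.Closure.ReflexiveTransitive using (Star)
open import Function.Bundles using (_⇔_)

record Structure (n : ℕ) : Set where
  field
    f     : Fin n → Fin n → Bool
    fstar : Fin n → Fin n → Bool
    R     : Fin n → Fin n → Fin n → Bool

module _ {n : ℕ} (M : Structure n) where
  open Structure M

  F : Fin n → Fin n → Set
  F u v = T (f u v)

  F* : Fin n → Fin n → Set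
  F* u v = T (fstar u v)

  Fx* : Fin n → Fin n → Fin n → Set
  Fx* x u v = T (R x u v)

  Fx : Fin n → Fin n → Fin n → Set
  Fx x u v = F u v × ¬ (u ≡ x)

  Functional : Set
  Functional = ∀ u v w → F u v → F u w → v ≡ w

  N1 N2 N3 N4 N5 N6 N7 : Set
  N1 = ∀ x u v → Fx* x u v ⇔ (u ≡ v ⊎ ∃[ z ] (Fx x u z × Fx* x z v))
  N2 = ∀ x u v w → Fx* x u v → Fx* x v w → Fx* x u w
  N3 = ∀ x u v → Fx* x u v → F* u v
  N4 = ∀ x y z u → Fx* y u x → Fx* z u y → Fx* z u x
  N5 = ∀ x y u → F* u x → Fx* y u x ⊎ Fx* x u y
  N6 = ∀ x y z u → Fx* y u x → Fx* z u y → Fx* z x y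
  N7 = ∀ x u v → F x u → F* u v → Fx* x u v

  IsTCModel : Set
  IsTCModel =
    (∀ u v → F* u v ⇔ Star F u v) ×
    (∀ x u v → Fx* x u v ⇔ Star (Fx x) u v)

-- Unfolding N1 for (f^x)^*(u,v) only ever follows f, since f is functional, so the
-- unfolding is the f-path from u.  It cannot enter a cycle before reaching v:
-- closing a cycle at w through a node s with (f^x)^*(s,v) gives, by N3 and N7,
-- (f^w)^*(s,v), but the f-path from s meets w before v.  Finiteness then makes
-- the unfolding end at v, which gives the interesting half of the R-clause;
-- the f*-clause follows because N3 and N5 make f*(u,v) equivalent to
-- (f^v)^*(u,v), and an f-path to v may be cut at its first visit to v.
module Submission where

open import Defs
open import Data.Nat using (ℕ)
open import Data.Fin using (Fin; _≟_)
open import Data.Fin.Subset using (Subset; ⊤; _-_; _∈_; _∉_; _⊂_)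
open import Data.Fin.Subset.Properties using (_∈?_; ∈⊤; x∈p⇒p-x⊂p; x∈p∧x≢y⇒x∈p-y)
open import Data.Fin.Subset.Induction using (Acc; acc; ⊂-wellFounded)
open import Data.Product using (_×_; _,_; proj₁; ∃-syntax)
open import Data.Sum using (_⊎_; inj₁; inj₂; [_,_])
open import Data.Empty using (⊥; ⊥-elim)
open import Function using (_∘_; id)
open import Function.Bundles using (_⇔_; mk⇔; Equivalence)
open import Relation.Nullary using (yes; no)
open import Relation.Binary.Definitions using (DecidableEquality)
open import Relation.Binary.PropositionalEquality using (_≡_; _≢_; refl)
open import Relation.Binary.Construct.Closure.ReflexiveTransitive using (Star; ε; _◅_; _◅◅_)
import Relation.Binary.Construct.Closure.ReflexiveTransitive as Star

Star-cut-at-target : ∀ {A : Set} → DecidableEquality A → {S : A → A → Set} {u v : A} →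
  Star S u v → Star (λ p q → S p q × p ≢ v) u v
Star-cut-at-target _≟_ ε = ε
Star-cut-at-target _≟_ {u = u} {v} (s ◅ rest) with u ≟ v
... | yes refl = ε
... | no u≢v = (s , u≢v) ◅ Star-cut-at-target _≟_ rest

module _ {n : ℕ} {S : Fin n → Fin n → Set} {Q : Fin n → Set} {t : Fin n}
  (unfold : ∀ {w} → Q w → w ≡ t ⊎ ∃[ s ] (S w s × Q s))
  (no-cycle : ∀ {w s} → S w s → Q s → Star S s w → ⊥) where

  unfolding-reaches : ∀ {w} → Q w → Star S w t
  unfolding-reaches = walk (⊂-wellFounded ⊤) ∈⊤ (λ p∉⊤ → ⊥-elim (p∉⊤ ∈⊤))
    where
    -- U holds the nodes not yet visited; every visited node leads to w.
    walk : ∀ {U : Subset n} → Acc _⊂_ U → ∀ {w} → w ∈ U →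
           (∀ {p} → p ∉ U → Star S p w) → Q w → Star S w t
    walk {U} (acc smaller) {w} w∈U visited Qw with unfold Qw
    ... | inj₁ refl = ε
    ... | inj₂ (s , Sws , Qs) with s ∈? (U - w)
    ...   | yes s∈U-w = Sws ◅ walk (smaller (x∈p⇒p-x⊂p w∈U)) s∈U-w visited′ Qs
      where
      visited′ : ∀ {p} → p ∉ U - w → Star S p s
      visited′ {p} p∉ with p ≟ w
      ... | yes refl = Sws ◅ ε
      ... | no p≢w = visited (λ p∈U → p∉ (x∈p∧x≢y⇒x∈p-y p∈U p≢w)) ◅◅ (Sws ◅ ε)
    ...   | no s∉U-w = ⊥-elim (no-cycle Sws Qs back-to-w)
      where
      back-to-w : Star S s w
      back-to-w with s ≟ w
      ... | yes refl = ε
      ... | no s≢w = visited (λ s∈U → s∉U-w (x∈p∧x≢y⇒x∈p-y s∈U s≢w))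

module Nelson {n : ℕ} (M : Structure n) (n1 : N1 M) where

  Fx*-unfold : ∀ {x u v} → Fx* M x u v → u ≡ v ⊎ ∃[ z ] (Fx M x u z × Fx* M x z v)
  Fx*-unfold = Equivalence.to (n1 _ _ _)

  Star⇒Fx* : ∀ {x u v} → Star (Fx M x) u v → Fx* M x u v
  Star⇒Fx* ε = Equivalence.from (n1 _ _ _) (inj₁ refl)
  Star⇒Fx* (step ◅ rest) = Equivalence.from (n1 _ _ _) (inj₂ (_ , step , Star⇒Fx* rest))

  -- The f^c-path from a to v has to follow f from a, which meets c before v.
  Fx*-blocked-by-path : Functional M → ∀ {a c v} →
    Star (Fx M v) a c → Fx* M c a v → c ≡ v
  Fx*-blocked-by-path fun ε Fx*cav with Fx*-unfold Fx*cav
  ... | inj₁ c≡v = c≡v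
  ... | inj₂ (_ , (_ , c≢c) , _) = ⊥-elim (c≢c refl)
  Fx*-blocked-by-path fun ((Fab , a≢v) ◅ rest) Fx*cav with Fx*-unfold Fx*cav
  ... | inj₁ a≡v = ⊥-elim (a≢v a≡v)
  ... | inj₂ (z , (Faz , _) , Fx*czv) with fun _ z _ Faz Fab
  ...   | refl = Fx*-blocked-by-path fun rest Fx*czv

  Fx*⇒Star : Functional M → N3 M → N7 M → ∀ {x u v} → Fx* M x u v → Star (Fx M x) u v
  Fx*⇒Star fun n3 n7 {x} {v = v} =
    Star.map proj₁ ∘ unfolding-reaches {S = λ p q → Fx M x p q × p ≢ v} unfold no-cycle
    where
    unfold : ∀ {w} → Fx* M x w v → w ≡ v ⊎ ∃[ s ] ((Fx M x w s × w ≢ v) × Fx* M x s v)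
    unfold {w} Fx*wv with w ≟ v | Fx*-unfold Fx*wv
    ... | yes w≡v | _ = inj₁ w≡v
    ... | no _ | inj₁ w≡v = inj₁ w≡v
    ... | no w≢v | inj₂ (s , step , Fx*sv) = inj₂ (s , (step , w≢v) , Fx*sv)

    no-cycle : ∀ {w s} → Fx M x w s × w ≢ v → Fx* M x s v →
               Star (λ p q → Fx M x p q × p ≢ v) s w → ⊥
    no-cycle {w} {s} ((Fws , _) , w≢v) Fx*sv cycle =
      w≢v (Fx*-blocked-by-path fun (Star.map (λ ((Fpq , _) , p≢v) → Fpq , p≢v) cycle)
                                   (n7 w s v Fws (n3 x s v Fx*sv)))

F*⇔Fx*-target : ∀ {n} (M : Structure n) → N3 M → N5 M →
  ∀ {u v} → F* M u v ⇔ Fx* M v u v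
F*⇔Fx*-target M n3 n5 {u} {v} = mk⇔ ([ id , id ] ∘ n5 v v u) (n3 v u v)

proposition4p6 : (n : ℕ) (M : Structure n) →
    Functional M → N1 M → N2 M → N3 M → N4 M → N5 M → N6 M → N7 M →
    IsTCModel M
proposition4p6 n M fun n1 _ n3 _ n5 _ n7 = F*-clause , R-clause
  where
  open Nelson M n1

  R-clause : ∀ x u v → Fx* M x u v ⇔ Star (Fx M x) u v
  R-clause x u v = mk⇔ (Fx*⇒Star fun n3 n7) Star⇒Fx*

  F*-clause : ∀ u v → F* M u v ⇔ Star (F M) u v
  F*-clause u v = mk⇔
    (Star.map proj₁ ∘ Equivalence.to (R-clause v u v) ∘ Equivalence.to (F*⇔Fx*-target M n3 n5))
    (Equivalence.from (F*⇔Fx*-target M n3 n5) ∘ Star⇒Fx* ∘ Star-cut-at-target _≟_)
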